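{- Let $(B,W)$ be a permutation group on a finite set, $B\neq I_1$, with $B\in GR\cup\{I_2\}$. Then $B\times I_2\in GR$.
   Context: A permutation group $(B,W)$ is a group $B$ of permutations of a set $W$; $I_n$ denotes the trivial group (identity only) acting on an $n$-element set; groups are considered up to permutation isomorphism. The direct product of $(B,W)$ and $(C,U)$ acts on $W\times U$ by $(b,c)(x,y)=(b(x),c(y))$. An edge-colored graph on a set $X$ is a function $E$ from the 2-element subsets of $X$ to a finite set of colors, with automorphisms the permutations $\sigma$ of $X$ satisfying $E(\{\sigma(x),\sigma(x')\})=E(\{x,x'\})$ for all distinct $x,x'$. $GR$ is the class of permutation groups that equal the full automorphism group of some edge-colored graph on their underlying set. -}

module Defs where

open import Data.Nat using (ℕ)
open import Data.Fin using (Fin)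
open import Data.Product using (Σ; _×_; _,_)
open import Relation.Binary.PropositionalEquality using (_≡_; _≢_)
open import Function.Bundles using (_↔_; Inverse; _⇔_)
open import Function.Construct.Identity using (↔-id)
open import Function.Construct.Composition using (_↔-∘_)
open import Function.Construct.Symmetry using (↔-sym)

Perm : Set → Set
Perm A = A ↔ A

app : {A : Set} → Perm A → A → A
app σ = Inverse.to σ

_≈ₚ_ : {A : Set} → Perm A → Perm A → Set
σ ≈ₚ τ = ∀ x → app σ x ≡ app τ x

record PermGroup (A : Set) : Set₁ where
  field
    _∈B : Perm A → Set
    resp : ∀ {σ τ} → σ ≈ₚ τ → σ ∈B → τ ∈B
    id∈ : ↔-id A ∈B
    ∘∈ : ∀ {σ τ} → σ ∈B → τ ∈B → (σ ↔-∘ τ) ∈B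
    ⁻¹∈ : ∀ {σ} → σ ∈B → ↔-sym σ ∈B
open PermGroup public

-- An edge-colored graph on A with k colors: a colour for every
-- 2-element subset {x, x'}, encoded as a symmetric function whose
-- values on the diagonal are ignored.
record EdgeColoring (A : Set) (k : ℕ) : Set where
  field
    E : A → A → Fin k
    sym : ∀ x y → E x y ≡ E y x
open EdgeColoring public

IsAut : {A : Set} {k : ℕ} → EdgeColoring A k → Perm A → Set
IsAut G σ = ∀ x y → x ≢ y → E G (app σ x) (app σ y) ≡ E G x y

InGR : (A : Set) → (Perm A → Set) → Set
InGR A P = Σ ℕ λ k → Σ (EdgeColoring A k) λ G → ∀ σ → P σ ⇔ IsAut G σ

Trivial : {A : Set} → PermGroup A → Set
Trivial B = ∀ σ → (B ∈B) σ → ∀ x → app σ x ≡ x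

ProdI₂ : {A : Set} → PermGroup A → Perm (A × Fin 2) → Set
ProdI₂ {A} B ρ = Σ (Perm A) λ σ → (B ∈B) σ × (∀ x y → app ρ (x , y) ≡ (app σ x , y))

-- Put two copies of W side by side. Inside each copy repeat the graph of B, in colours
-- reserved for that copy, and colour the edges between the copies by a colouring
-- `cross`. As soon as |W| ≥ 2 every vertex lies on an edge inside its own copy, so an
-- automorphism ρ fixes both copies setwise and acts on them by automorphisms s₀, s₁ of
-- the original graph with cross (s₀ x) (s₁ y) = cross x y. For B ∈ GR take cross to be
-- the equality indicator, which forces s₀ = s₁; for trivial B take cross to be an
-- injective code of the pair, which forces s₀ = s₁ = id.
module Submission where

open import Defs hiding (sym)
open import Data.Nat using (ℕ; zero; suc; _+_; _*_)
open import Data.Fin using (Fin; zero; suc; combine; punchIn)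
open import Data.Fin.Properties using (+↔⊎; combine-injective; punchInᵢ≢i; inj⇒≟)
open import Data.Product using (∃; _×_; _,_; proj₁; proj₂)
open import Data.Sum using (_⊎_; inj₁; inj₂)
open import Data.Sum.Properties using (inj₁-injective; inj₂-injective)
open import Data.Sum.Function.Propositional using (_⊎-↔_)
open import Data.Empty using (⊥-elim)
open import Relation.Nullary using (¬_; yes; no)
open import Relation.Binary.Definitions using (DecidableEquality)
open import Relation.Binary.PropositionalEquality
  using (_≡_; _≢_; refl; sym; trans; cong; cong₂; subst₂; module ≡-Reasoning)
open import Function.Bundles using (_↔_; Inverse; Injection; mk⇔; mk↔ₛ′; Equivalence)
open import Function.Properties.Inverse using (↔-refl; ↔-sym; ↔-trans; ↔⇒↣)
open import Function.Construct.Identity using (↔-id)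
open import Function.Base using (_∘_)

↔-injective : {A B : Set} (f : A ↔ B) {x y : A} → Inverse.to f x ≡ Inverse.to f y → x ≡ y
↔-injective f = Injection.injective (↔⇒↣ f)

↔Fin1⇒Trivial : {A : Set} → A ↔ Fin 1 → (B : PermGroup A) → Trivial B
↔Fin1⇒Trivial f B σ _ x = ↔-injective f (unique (Inverse.to f (app σ x)) (Inverse.to f x))
  where
    unique : (i j : Fin 1) → i ≡ j
    unique zero zero = refl

↔Fin-distinctPoint : {A : Set} {n : ℕ} → A ↔ Fin n → n ≢ 1 → (x : A) → ∃ λ y → y ≢ x
↔Fin-distinctPoint {n = zero} f _ x with () ← Inverse.to f x
↔Fin-distinctPoint {n = suc zero} f n≢1 x = ⊥-elim (n≢1 refl)
↔Fin-distinctPoint {n = suc (suc _)} f _ x = Inverse.from f j , j≢i ∘ cong (Inverse.to f)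
  where
    i = Inverse.to f x
    j = punchIn i zero
    j≢i : Inverse.to f (Inverse.from f j) ≢ i
    j≢i e = punchInᵢ≢i i zero (trans (sym (Inverse.strictlyInverseˡ f j)) e)

module _ {A F : Set} (ρ : Perm (A × F)) (fibre-preserved : ∀ p → proj₂ (app ρ p) ≡ proj₂ p) where

  fibrePerm : F → Perm A
  fibrePerm i = mk↔ₛ′ to from to∘from from∘to
    where
      to : A → A
      to x = proj₁ (app ρ (x , i))
      from : A → A
      from z = proj₁ (Inverse.from ρ (z , i))
      to∘from : ∀ z → to (from z) ≡ z
      to∘from z = cong proj₁ (begin
          app ρ (proj₁ w , i)        ≡⟨ cong (λ j → app ρ (proj₁ w , j)) w-in-fibre ⟨
          app ρ w                    ≡⟨ Inverse.strictlyInverseˡ ρ (z , i) ⟩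
          (z , i)                    ∎)
        where
          open ≡-Reasoning
          w = Inverse.from ρ (z , i)
          w-in-fibre : proj₂ w ≡ i
          w-in-fibre = trans (sym (fibre-preserved w)) (cong proj₂ (Inverse.strictlyInverseˡ ρ (z , i)))
      from∘to : ∀ x → from (to x) ≡ x
      from∘to x = cong proj₁ (trans (cong (Inverse.from ρ) ρxi≡) (Inverse.strictlyInverseʳ ρ (x , i)))
        where
          ρxi≡ : (to x , i) ≡ app ρ (x , i)
          ρxi≡ = cong (to x ,_) (sym (fibre-preserved (x , i)))

  app-fibrePerm : ∀ x i → app ρ (x , i) ≡ (app (fibrePerm i) x , i)
  app-fibrePerm x i = cong (app (fibrePerm i) x ,_) (fibre-preserved (x , i))

module _ {A : Set} (_≟_ : DecidableEquality A) where

  sameness : A → A → Fin 2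
  sameness x y with x ≟ y
  ... | yes _ = zero
  ... | no _  = suc zero

  sameness-refl : ∀ x → sameness x x ≡ zero
  sameness-refl x with x ≟ x
  ... | yes _   = refl
  ... | no x≢x  = ⊥-elim (x≢x refl)

  sameness≡zero⇒≡ : ∀ {x y} → sameness x y ≡ zero → x ≡ y
  sameness≡zero⇒≡ {x} {y} e with x ≟ y
  sameness≡zero⇒≡ e  | yes x≡y = x≡y
  sameness≡zero⇒≡ () | no _

  sameness-perm : (σ : Perm A) → ∀ x y → sameness (app σ x) (app σ y) ≡ sameness x y
  sameness-perm σ x y with app σ x ≟ app σ y | x ≟ y
  ... | yes _   | yes _   = refl
  ... | no _    | no _    = refl
  ... | yes σx≡σy | no x≢y = ⊥-elim (x≢y (↔-injective σ σx≡σy))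
  ... | no σx≢σy  | yes x≡y = ⊥-elim (σx≢σy (cong (app σ) x≡y))

module Doubling {A : Set} {k m : ℕ} (G : EdgeColoring A k) (cross : A → A → Fin m) where

  Colour : Set
  Colour = Fin k ⊎ Fin k ⊎ Fin m

  colourCode : Colour ↔ Fin (k + (k + m))
  colourCode = ↔-trans (↔-refl ⊎-↔ ↔-sym +↔⊎) (↔-sym +↔⊎)

  encode : Colour → Fin (k + (k + m))
  encode = Inverse.to colourCode

  colour : A × Fin 2 → A × Fin 2 → Colour
  colour (x , zero)     (y , zero)     = inj₁ (E G x y)
  colour (x , suc zero) (y , suc zero) = inj₂ (inj₁ (E G x y))
  colour (x , zero)     (y , suc zero) = inj₂ (inj₂ (cross x y))
  colour (x , suc zero) (y , zero)     = inj₂ (inj₂ (cross y x))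

  colour-sym : ∀ p q → colour p q ≡ colour q p
  colour-sym (x , zero)     (y , zero)     = cong inj₁ (EdgeColoring.sym G x y)
  colour-sym (x , suc zero) (y , suc zero) = cong (λ c → inj₂ (inj₁ c)) (EdgeColoring.sym G x y)
  colour-sym (x , zero)     (y , suc zero) = refl
  colour-sym (x , suc zero) (y , zero)     = refl

  doubled : EdgeColoring (A × Fin 2) (k + (k + m))
  doubled = record { E = λ p q → encode (colour p q) ; sym = λ p q → cong encode (colour-sym p q) }

  colour-withinCopy⇒copy : ∀ {a b x y} i j l → colour (a , j) (b , l) ≡ colour (x , i) (y , i) → j ≡ i
  colour-withinCopy⇒copy zero       zero       _          _  = refl
  colour-withinCopy⇒copy (suc zero) (suc zero) _          _  = refl
  colour-withinCopy⇒copy zero       (suc zero) zero       ()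
  colour-withinCopy⇒copy zero       (suc zero) (suc zero) ()
  colour-withinCopy⇒copy (suc zero) zero       zero       ()
  colour-withinCopy⇒copy (suc zero) zero       (suc zero) ()

  colour-withinCopy-injective : ∀ {a b x y} i → colour (a , i) (b , i) ≡ colour (x , i) (y , i) →
                                E G a b ≡ E G x y
  colour-withinCopy-injective zero       e = inj₁-injective e
  colour-withinCopy-injective (suc zero) e = inj₁-injective (inj₂-injective e)

  colour-crossCopy-injective : ∀ {a b x y} → colour (a , zero) (b , suc zero) ≡ colour (x , zero) (y , suc zero) →
                               cross a b ≡ cross x y
  colour-crossCopy-injective e = inj₂-injective (inj₂-injective e)

  copywise-isAut : (σ : Perm A) → IsAut G σ → (∀ x y → cross (app σ x) (app σ y) ≡ cross x y) →
                   (ρ : Perm (A × Fin 2)) → (∀ x i → app ρ (x , i) ≡ (app σ x , i)) → IsAut doubled ρ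
  copywise-isAut σ σ-aut σ-cross ρ ρ≡ (x , i) (y , j) p≢q
    rewrite ρ≡ x i | ρ≡ y j = cong encode (preserved i j p≢q)
    where
      preserved : ∀ i j → (x , i) ≢ (y , j) → colour (app σ x , i) (app σ y , j) ≡ colour (x , i) (y , j)
      preserved zero       zero       p≢q = cong inj₁ (σ-aut x y (λ x≡y → p≢q (cong (_, zero) x≡y)))
      preserved (suc zero) (suc zero) p≢q = cong (λ c → inj₂ (inj₁ c)) (σ-aut x y (λ x≡y → p≢q (cong (_, suc zero) x≡y)))
      preserved zero       (suc zero) _   = cong (λ c → inj₂ (inj₂ c)) (σ-cross x y)
      preserved (suc zero) zero       _   = cong (λ c → inj₂ (inj₂ c)) (σ-cross y x)

  module Automorphism (distinctPoint : (x : A) → ∃ λ y → y ≢ x) (ρ : Perm (A × Fin 2)) (ρ-aut : IsAut doubled ρ) where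

    colour-preserved : ∀ p q → p ≢ q → colour (app ρ p) (app ρ q) ≡ colour p q
    colour-preserved p q p≢q = Injection.injective (↔⇒↣ colourCode) (ρ-aut p q p≢q)

    -- (x , i) lies on an edge inside copy i, whose colour only edges inside copy i carry.
    copy-preserved : ∀ p → proj₂ (app ρ p) ≡ proj₂ p
    copy-preserved (x , i) =
      colour-withinCopy⇒copy i _ _ (colour-preserved (x , i) (y , i) (λ e → y≢x (sym (cong proj₁ e))))
      where
        y = proj₁ (distinctPoint x)
        y≢x = proj₂ (distinctPoint x)

    layer : Fin 2 → Perm A
    layer = fibrePerm ρ copy-preserved

    app-layer : ∀ x i → app ρ (x , i) ≡ (app (layer i) x , i)
    app-layer = app-fibrePerm ρ copy-preserved

    colour-layers : ∀ x i y j → (x , i) ≢ (y , j) →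
                    colour (app (layer i) x , i) (app (layer j) y , j) ≡ colour (x , i) (y , j)
    colour-layers x i y j p≢q =
      subst₂ (λ p q → colour p q ≡ colour (x , i) (y , j)) (app-layer x i) (app-layer y j)
        (colour-preserved (x , i) (y , j) p≢q)

    layer-isAut : ∀ i → IsAut G (layer i)
    layer-isAut i x y x≢y =
      colour-withinCopy-injective i (colour-layers x i y i (λ e → x≢y (cong proj₁ e)))

    layer-cross : ∀ x y → cross (app (layer zero) x) (app (layer (suc zero)) y) ≡ cross x y
    layer-cross x y = colour-crossCopy-injective (colour-layers x zero y (suc zero) (λ ()))

open Doubling using (doubled; copywise-isAut)

GR×I₂∈GR : {A : Set} (B : PermGroup A) → DecidableEquality A → ((x : A) → ∃ λ y → y ≢ x) →
           InGR A (B ∈B) → InGR (A × Fin 2) (ProdI₂ B)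
GR×I₂∈GR {A} B _≟_ distinctPoint (k , G , B⇔AutG) =
  k + (k + 2) , doubled G cross , λ ρ → mk⇔ (lift ρ) (restrict ρ)
  where
    cross = sameness _≟_

    lift : ∀ ρ → ProdI₂ B ρ → IsAut (doubled G cross) ρ
    lift ρ (σ , σ∈B , ρ≡) =
      copywise-isAut G cross σ (Equivalence.to (B⇔AutG σ) σ∈B) (sameness-perm _≟_ σ) ρ ρ≡

    restrict : ∀ ρ → IsAut (doubled G cross) ρ → ProdI₂ B ρ
    restrict ρ ρ-aut = layer zero , Equivalence.from (B⇔AutG (layer zero)) (layer-isAut zero) , ρ≡
      where
        open Doubling.Automorphism G cross distinctPoint ρ ρ-aut
        layers-agree : ∀ x → app (layer zero) x ≡ app (layer (suc zero)) x
        layers-agree x = sameness≡zero⇒≡ _≟_ (trans (layer-cross x x) (sameness-refl _≟_ x))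
        ρ≡ : ∀ x i → app ρ (x , i) ≡ (app (layer zero) x , i)
        ρ≡ x zero       = app-layer x zero
        ρ≡ x (suc zero) = trans (app-layer x (suc zero)) (cong (_, suc zero) (sym (layers-agree x)))

Trivial×I₂∈GR : {A : Set} {n : ℕ} → A ↔ Fin n → ((x : A) → ∃ λ y → y ≢ x) →
                (B : PermGroup A) → Trivial B → InGR (A × Fin 2) (ProdI₂ B)
Trivial×I₂∈GR {A} {n} f distinctPoint B B-trivial =
  1 + (1 + n * n) , doubled G cross , λ ρ → mk⇔ (lift ρ) (restrict ρ)
  where
    G : EdgeColoring A 1
    G = record { E = λ _ _ → zero ; sym = λ _ _ → refl }

    cross : A → A → Fin (n * n)
    cross x y = combine (Inverse.to f x) (Inverse.to f y)

    lift : ∀ ρ → ProdI₂ B ρ → IsAut (doubled G cross) ρ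
    lift ρ (σ , σ∈B , ρ≡) = copywise-isAut G cross σ (λ _ _ _ → refl) σ-cross ρ ρ≡
      where
        σ-cross : ∀ x y → cross (app σ x) (app σ y) ≡ cross x y
        σ-cross x y = cong₂ cross (B-trivial σ σ∈B x) (B-trivial σ σ∈B y)

    restrict : ∀ ρ → IsAut (doubled G cross) ρ → ProdI₂ B ρ
    restrict ρ ρ-aut = ↔-id A , id∈ B , ρ≡
      where
        open Doubling.Automorphism G cross distinctPoint ρ ρ-aut
        layers-fix : ∀ x → Inverse.to f (app (layer zero) x) ≡ Inverse.to f x
                         × Inverse.to f (app (layer (suc zero)) x) ≡ Inverse.to f x
        layers-fix x = combine-injective _ _ _ _ (layer-cross x x)
        ρ≡ : ∀ x i → app ρ (x , i) ≡ (x , i)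
        ρ≡ x zero       = trans (app-layer x zero) (cong (_, zero) (↔-injective f (proj₁ (layers-fix x))))
        ρ≡ x (suc zero) = trans (app-layer x (suc zero)) (cong (_, suc zero) (↔-injective f (proj₂ (layers-fix x))))

theorem3p9 : (n : ℕ) (A : Set) → A ↔ Fin n → (B : PermGroup A) →
    ¬ (n ≡ 1 × Trivial B) →
    (InGR A (B ∈B) ⊎ (n ≡ 2 × Trivial B)) →
    InGR (A × Fin 2) (ProdI₂ B)
theorem3p9 n A f B notI₁ (inj₁ B∈GR) =
  GR×I₂∈GR B (inj⇒≟ (↔⇒↣ f)) (↔Fin-distinctPoint f n≢1) B∈GR
  where
    n≢1 : n ≢ 1
    n≢1 refl = notI₁ (refl , ↔Fin1⇒Trivial f B)
theorem3p9 .2 A f B _ (inj₂ (refl , B-trivial)) =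
  Trivial×I₂∈GR f (↔Fin-distinctPoint f (λ ())) B B-trivial
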